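{- Let $G=(V,E)$ be a network with source $s$, sink $t$, capacities $c$, and let $f$ be an integral flow satisfying the capacity constraints but not flow conservation. Suppose there is no path with positive residual capacity in $G_f$ from a node of $A'_f$ to a node of $B'_f$. Let $h$ be the flow obtained from $f$ by sending flow along a path of positive residual capacity in $G_f$ from a node of $A'_f$ to $s$ (or from $t$ to a node of $B'_f$). Then there is no path with positive residual capacity in $G_h$ from a node of $A'_h$ to a node of $B'_h$.
   Context: For a flow $f$ with $f_e\le c_e$, the residual graph $G_f$ has, for each $e=(u,v)\in E$, an edge $(u,v)$ of residual capacity $c_e-f_e$ and a reverse edge $(v,u)$ of residual capacity $f_e$. A node has positive excess if its incoming flow exceeds its outgoing flow, and positive deficit if its outgoing flow exceeds its incoming flow. $A'_f$ (resp. $B'_f$) denotes the set of nodes in $V\setminus\{s,t\}$ with positive excess (resp. positive deficit) under $f$. -}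

module Defs where

open import Data.Nat using (ℕ; zero; suc; _+_; _*_; _∸_; _≤_; _<_)
open import Data.Fin using (Fin; _≟_)
open import Data.List using (List; []; _∷_; map; allFin)
open import Data.Nat.ListAction using (sum)
open import Data.List.Relation.Unary.Unique.Propositional using (Unique)
open import Data.Product using (Σ; _×_; _,_)
open import Data.Bool using (if_then_else_)
open import Relation.Nullary using (¬_)
open import Relation.Nullary.Decidable using (⌊_⌋)
open import Relation.Binary.PropositionalEquality using (_≡_; _≢_)

-- A network: nodes Fin n, edges Fin m (parallel edges / arbitrary directed
-- multigraph), each edge e going from tail e to head e, source s, sink t,
-- integral capacities cap.
record Network : Set where
  field
    n m       : ℕ
    s t       : Fin n
    tail head : Fin m → Fin n
    cap       : Fin m → ℕ

module _ (N : Network) where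
  open Network N

  Flow : Set
  Flow = Fin m → ℕ

  Feasible : Flow → Set
  Feasible f = ∀ e → f e ≤ cap e

  inflow : Flow → Fin n → ℕ
  inflow f v = sum (map (λ e → if ⌊ head e ≟ v ⌋ then f e else 0) (allFin m))

  outflow : Flow → Fin n → ℕ
  outflow f v = sum (map (λ e → if ⌊ tail e ≟ v ⌋ then f e else 0) (allFin m))

  Conserves : Flow → Set
  Conserves f = ∀ v → v ≢ s → v ≢ t → inflow f v ≡ outflow f v

  A' : Flow → Fin n → Set
  A' f v = v ≢ s × v ≢ t × outflow f v < inflow f v

  B' : Flow → Fin n → Set
  B' f v = v ≢ s × v ≢ t × inflow f v < outflow f v

  excess : Flow → Fin n → ℕ
  excess f v = inflow f v ∸ outflow f v

  deficit : Flow → Fin n → ℕ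
  deficit f v = outflow f v ∸ inflow f v

  -- residual arcs: each edge e gives a forward arc (tail e → head e)
  -- and a reverse arc (head e → tail e)
  data Dir : Set where
    fwd bwd : Dir

  Arc : Set
  Arc = Fin m × Dir

  src : Arc → Fin n
  src (e , fwd) = tail e
  src (e , bwd) = head e

  dst : Arc → Fin n
  dst (e , fwd) = head e
  dst (e , bwd) = tail e

  rescap : Flow → Arc → ℕ
  rescap f (e , fwd) = cap e ∸ f e
  rescap f (e , bwd) = f e

  data Walk (f : Flow) : Fin n → Fin n → List Arc → Set where
    []  : ∀ {u} → Walk f u u []
    _∷_ : ∀ {u v a as} → (src a ≡ u × 0 < rescap f a) →
          Walk f (dst a) v as → Walk f u v (a ∷ as)

  vertices : Fin n → List Arc → List (Fin n)
  vertices u as = u ∷ map dst as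

  ResPath : Flow → Fin n → Fin n → List Arc → Set
  ResPath f u v as = Walk f u v as × Unique (vertices u as)

  NoPathAB : Flow → Set
  NoPathAB f = ∀ u v as → A' f u → B' f v → ¬ ResPath f u v as

  fwdUses : Fin m → List Arc → ℕ
  fwdUses e [] = 0
  fwdUses e ((e' , fwd) ∷ as) = (if ⌊ e ≟ e' ⌋ then 1 else 0) + fwdUses e as
  fwdUses e ((e' , bwd) ∷ as) = fwdUses e as

  bwdUses : Fin m → List Arc → ℕ
  bwdUses e [] = 0
  bwdUses e ((e' , fwd) ∷ as) = bwdUses e as
  bwdUses e ((e' , bwd) ∷ as) = (if ⌊ e ≟ e' ⌋ then 1 else 0) + bwdUses e as

  augment : Flow → List Arc → ℕ → Flow
  augment f as δ e = (f e + δ * fwdUses e as) ∸ δ * bwdUses e as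

{-# OPTIONS --safe #-}
module Submission where

-- Sending δ along the residual path Q changes the excess only at the two ends of Q: it drops by δ at
-- the start and rises by δ at the end. Since one end is s or t and δ is at most the excess (deficit)
-- of the other end, this gives A'_h ⊆ A'_f and B'_h ⊆ B'_f. A residual arc of G_h that is not
-- residual in G_f reverses an arc of Q, so both its ends lie on Q. If Q starts in A'_f, the nodes of Q
-- are reachable from A'_f in G_f, hence so is every node reachable from A'_h in G_h; if Q ends in
-- B'_f, dually every node reaching B'_h in G_h reaches B'_f in G_f. In both cases a residual path
-- from A'_h to B'_h in G_h would yield one from A'_f to B'_f in G_f.

open import Defs
open import Data.Nat using (ℕ; suc; _+_; _*_; _≤_; _<_; z≤n)
open import Data.Nat.Properties
  using (+-assoc; +-comm; +-cancelʳ-≡; +-identityʳ; *-zeroʳ; *-identityʳ; *-distribˡ-+; +-cancelˡ-<;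
         +-monoˡ-≤; +-monoˡ-<; +-monoʳ-<; <-irrefl; <-≤-trans; ≤-trans; ≤-reflexive; <⇒≤;
         m≤m+n; m≤n+m; m∸n+n≡m; m∸n≤m; ∸-monoʳ-≤; n≢0⇒n>0; +-commutativeSemigroup; module ≤-Reasoning)
  renaming (_≟_ to _≟ℕ_)
open import Data.Nat.ListAction using (sum)
open import Data.Fin using (Fin; _≟_) renaming (zero to fzero; suc to fsuc)
open import Data.List using (List; []; _∷_; map; allFin; _++_)
open import Data.List.Properties using (map-tabulate; map-cong)
open import Data.List.Relation.Unary.All using (All; []; _∷_)
open import Data.List.Relation.Unary.All.Properties.Core using (¬Any⇒All¬)
open import Data.List.Relation.Unary.Any using (here; there; any?)
open import Data.List.Relation.Unary.AllPairs using ([]; _∷_)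
open import Data.List.Relation.Unary.Unique.Propositional using (Unique)
open import Data.List.Membership.Propositional using (_∈_)
open import Data.Product using (Σ; _×_; _,_; proj₁; proj₂; ∃-syntax)
open import Data.Sum using (_⊎_; inj₁; inj₂)
open import Data.Bool using (Bool; true; false; if_then_else_)
open import Data.Empty using (⊥-elim)
open import Function using (_∘_; id)
open import Relation.Nullary using (¬_; yes; no)
open import Relation.Nullary.Decidable using (⌊_⌋; ⌊⌋-map′)
open import Relation.Binary.PropositionalEquality
open import Algebra.Properties.CommutativeSemigroup +-commutativeSemigroup using (interchange; x∙yz≈y∙xz; x∙yz≈xz∙y)

private variable
  A : Set
  k : ℕ

pointMass : Fin k → ℕ → Fin k → ℕ
pointMass x δ y = if ⌊ x ≟ y ⌋ then δ else 0

pointMass-refl : (x : Fin k) (δ : ℕ) → pointMass x δ x ≡ δ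
pointMass-refl x δ with x ≟ x
... | yes _   = refl
... | no x≢x = ⊥-elim (x≢x refl)

pointMass-≢ : {x y : Fin k} (δ : ℕ) → x ≢ y → pointMass x δ y ≡ 0
pointMass-≢ {x = x} {y} δ x≢y with x ≟ y
... | yes x≡y = ⊥-elim (x≢y x≡y)
... | no _    = refl

*-pointMass : (δ : ℕ) (x y : Fin k) → δ * pointMass x 1 y ≡ pointMass x δ y
*-pointMass δ x y with ⌊ x ≟ y ⌋
... | true  = *-identityʳ δ
... | false = *-zeroʳ δ

module _ (p : A → Bool) where

  sumWhere : (A → ℕ) → List A → ℕ
  sumWhere g L = sum (map (λ e → if p e then g e else 0) L)

  sumWhere-cong : (g g′ : A → ℕ) (L : List A) → (∀ e → g e ≡ g′ e) → sumWhere g L ≡ sumWhere g′ L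
  sumWhere-cong g g′ L eq = cong sum (map-cong (λ e → cong (if p e then_else 0) (eq e)) L)

  sumWhere-0 : (L : List A) → sumWhere (λ _ → 0) L ≡ 0
  sumWhere-0 []      = refl
  sumWhere-0 (e ∷ L) with p e
  ... | true  = sumWhere-0 L
  ... | false = sumWhere-0 L

  sumWhere-+ : (g g′ : A → ℕ) (L : List A) →
               sumWhere (λ e → g e + g′ e) L ≡ sumWhere g L + sumWhere g′ L
  sumWhere-+ g g′ []      = refl
  sumWhere-+ g g′ (e ∷ L) rewrite sumWhere-+ g g′ L with p e
  ... | true  = interchange (g e) (g′ e) (sumWhere g L) (sumWhere g′ L)
  ... | false = refl

  sumWhere-* : (c : ℕ) (g : A → ℕ) (L : List A) → sumWhere (λ e → c * g e) L ≡ c * sumWhere g L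
  sumWhere-* c g []      = sym (*-zeroʳ c)
  sumWhere-* c g (e ∷ L) rewrite sumWhere-* c g L with p e
  ... | true  = sym (*-distribˡ-+ c (g e) (sumWhere g L))
  ... | false = refl

  sumWhere-affine : (c : ℕ) (g₁ g₂ g₃ g₄ : A → ℕ) (L : List A) →
                    (∀ e → g₁ e + c * g₂ e ≡ g₃ e + c * g₄ e) →
                    sumWhere g₁ L + c * sumWhere g₂ L ≡ sumWhere g₃ L + c * sumWhere g₄ L
  sumWhere-affine c g₁ g₂ g₃ g₄ L eq = begin
    sumWhere g₁ L + c * sumWhere g₂ L           ≡⟨ cong (_ +_) (sumWhere-* c g₂ L) ⟨
    sumWhere g₁ L + sumWhere (λ e → c * g₂ e) L ≡⟨ sumWhere-+ g₁ _ L ⟨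
    sumWhere (λ e → g₁ e + c * g₂ e) L          ≡⟨ sumWhere-cong _ _ L eq ⟩
    sumWhere (λ e → g₃ e + c * g₄ e) L          ≡⟨ sumWhere-+ g₃ _ L ⟩
    sumWhere g₃ L + sumWhere (λ e → c * g₄ e) L ≡⟨ cong (_ +_) (sumWhere-* c g₄ L) ⟩
    sumWhere g₃ L + c * sumWhere g₄ L           ∎
    where open ≡-Reasoning

sumWhere-allFin-suc : ∀ {k} (p : Fin (suc k) → Bool) (g : Fin (suc k) → ℕ) →
  sumWhere p g (allFin (suc k)) ≡ (if p fzero then g fzero else 0) + sumWhere (p ∘ fsuc) (g ∘ fsuc) (allFin k)
sumWhere-allFin-suc {k} p g =
  cong (λ L → term fzero + sum L) (trans (map-tabulate fsuc term) (sym (map-tabulate id (term ∘ fsuc))))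
  where
  term : Fin (suc k) → ℕ
  term e = if p e then g e else 0

sumWhere-≟ : (e′ : Fin k) (g : Fin k → ℕ) → sumWhere (λ e → ⌊ e ≟ e′ ⌋) g (allFin k) ≡ g e′
sumWhere-≟ {suc k} fzero g = begin
  sumWhere (λ e → ⌊ e ≟ fzero ⌋) g (allFin (suc k))      ≡⟨ sumWhere-allFin-suc (λ e → ⌊ e ≟ fzero ⌋) g ⟩
  g fzero + sumWhere (λ _ → false) (λ _ → 0) (allFin k)  ≡⟨ cong (g fzero +_) (sumWhere-0 (λ _ → false) (allFin k)) ⟩
  g fzero + 0                                            ≡⟨ +-identityʳ (g fzero) ⟩
  g fzero                                                ∎
  where open ≡-Reasoning
sumWhere-≟ {suc k} (fsuc e′) g = begin
  sumWhere (λ e → ⌊ e ≟ fsuc e′ ⌋) g (allFin (suc k))          ≡⟨ sumWhere-allFin-suc (λ e → ⌊ e ≟ fsuc e′ ⌋) g ⟩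
  sumWhere (λ e → ⌊ fsuc e ≟ fsuc e′ ⌋) (g ∘ fsuc) (allFin k)  ≡⟨ cong sum (map-cong suc≟suc (allFin k)) ⟩
  sumWhere (λ e → ⌊ e ≟ e′ ⌋) (g ∘ fsuc) (allFin k)            ≡⟨ sumWhere-≟ e′ (g ∘ fsuc) ⟩
  g (fsuc e′)                                                  ∎
  where
  open ≡-Reasoning
  suc≟suc : ∀ e → (if ⌊ fsuc e ≟ fsuc e′ ⌋ then g (fsuc e) else 0) ≡ (if ⌊ e ≟ e′ ⌋ then g (fsuc e) else 0)
  suc≟suc e = cong (if_then g (fsuc e) else 0) (⌊⌋-map′ _ _ (e ≟ e′))

sumWhere-pointMass : ∀ {j} (end : Fin k → Fin j) (v : Fin j) (e′ : Fin k) →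
  sumWhere (λ e → ⌊ end e ≟ v ⌋) (λ e → pointMass e 1 e′) (allFin k) ≡ pointMass (end e′) 1 v
sumWhere-pointMass {k} end v e′ =
  trans (cong sum (map-cong (λ e → if-swap ⌊ end e ≟ v ⌋ ⌊ e ≟ e′ ⌋) (allFin k)))
        (sumWhere-≟ e′ (λ e → pointMass (end e) 1 v))
  where
  if-swap : ∀ b c → (if b then (if c then 1 else 0) else 0) ≡ (if c then (if b then 1 else 0) else 0)
  if-swap true  true  = refl
  if-swap true  false = refl
  if-swap false true  = refl
  if-swap false false = refl

sumWhere-pointMass-+ : ∀ {j} (end : Fin k → Fin j) (v : Fin j) (e′ : Fin k) (g : Fin k → ℕ) →
  sumWhere (λ e → ⌊ end e ≟ v ⌋) (λ e → pointMass e 1 e′ + g e) (allFin k)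
    ≡ pointMass (end e′) 1 v + sumWhere (λ e → ⌊ end e ≟ v ⌋) g (allFin k)
sumWhere-pointMass-+ {k} end v e′ g =
  trans (sumWhere-+ (λ e → ⌊ end e ≟ v ⌋) _ g (allFin k)) (cong (_+ _) (sumWhere-pointMass end v e′))

module _ (N : Network) where
  open Network N

  private variable
    g : Flow N
    x y z : Fin n
    a : Arc N
    as : List (Arc N)

  reverse : Arc N → Arc N
  reverse (e , fwd) = e , bwd
  reverse (e , bwd) = e , fwd

  src-reverse : ∀ a → src N (reverse a) ≡ dst N a
  src-reverse (e , fwd) = refl
  src-reverse (e , bwd) = refl

  dst-reverse : ∀ a → dst N (reverse a) ≡ src N a
  dst-reverse (e , fwd) = refl
  dst-reverse (e , bwd) = refl

  walk-snoc : Walk N g x (src N a) as → 0 < rescap N g a → Walk N g x (dst N a) (as ++ a ∷ [])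
  walk-snoc {a = a} [] pos = _∷_ {a = a} (refl , pos) []
  walk-snoc (step ∷ W) pos = step ∷ walk-snoc W pos

  walk-prefix : Walk N g x y as → a ∈ as → ∃[ ws ] Walk N g x (src N a) ws
  walk-prefix ((refl , _) ∷ W) (here refl) = [] , []
  walk-prefix (_∷_ {a = b} step W) (there a∈) with walk-prefix W a∈
  ... | ws , W′ = b ∷ ws , step ∷ W′

  walk-suffix : Walk N g x y as → a ∈ as → ∃[ ws ] Walk N g (dst N a) y ws
  walk-suffix (_ ∷ W) (here refl) = _ , W
  walk-suffix (_ ∷ W) (there a∈)  = walk-suffix W a∈

  path-from : ResPath N g x y as → z ∈ vertices N x as → ∃[ ps ] ResPath N g z y ps
  path-from                    W             (here refl) = _ , W
  path-from {as = _ ∷ _} (_ ∷ W , _ ∷ uniq) (there z∈)  = path-from (W , uniq) z∈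

  walk⇒path : Walk N g x y as → ∃[ ps ] ResPath N g x y ps
  walk⇒path []                  = [] , [] , [] ∷ []
  walk⇒path {x = x} (_∷_ {a = a} step W) with walk⇒path W
  ... | ps , W′ , uniq with any? (x ≟_) (vertices N _ ps)
  ...   | yes x∈ = path-from (W′ , uniq) x∈
  ...   | no  x∉ = a ∷ ps , step ∷ W′ , ¬Any⇒All¬ _ x∉ ∷ uniq

  walk-preserves : (R : Fin n → Set) → (∀ a → 0 < rescap N g a → R (src N a) → R (dst N a)) →
                   Walk N g x y as → R x → R y
  walk-preserves R step []               r = r
  walk-preserves R step (_∷_ {a = a} (refl , pos) W) r = walk-preserves R step W (step a pos r)

  walk-reflects : (R : Fin n → Set) → (∀ a → 0 < rescap N g a → R (dst N a) → R (src N a)) →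
                  Walk N g x y as → R y → R x
  walk-reflects R step []               r = r
  walk-reflects R step (_∷_ {a = a} (refl , pos) W) r = step a pos (walk-reflects R step W r)

  Reachable : Flow N → (Fin n → Set) → Fin n → Set
  Reachable g P y = ∃[ z ] P z × ∃[ ws ] Walk N g z y ws

  Coreachable : Flow N → (Fin n → Set) → Fin n → Set
  Coreachable g P y = ∃[ z ] P z × ∃[ ws ] Walk N g y z ws

  NoPathAB⇒¬Reachable : NoPathAB N g → B' N g y → ¬ Reachable g (A' N g) y
  NoPathAB⇒¬Reachable noPath By (z , Az , _ , W) with walk⇒path W
  ... | ps , path = noPath z _ ps Az By path

  NoPathAB⇒¬Coreachable : NoPathAB N g → A' N g y → ¬ Coreachable g (B' N g) y
  NoPathAB⇒¬Coreachable noPath Ay (z , Bz , _ , W) with walk⇒path W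
  ... | ps , path = noPath _ z ps Ay Bz path

  fwdUses>0⇒∈ : ∀ e as → 0 < fwdUses N e as → (e , fwd) ∈ as
  fwdUses>0⇒∈ e ((e′ , fwd) ∷ as) pos with e ≟ e′
  ... | yes refl = here refl
  ... | no _     = there (fwdUses>0⇒∈ e as pos)
  fwdUses>0⇒∈ e ((e′ , bwd) ∷ as) pos = there (fwdUses>0⇒∈ e as pos)

  bwdUses>0⇒∈ : ∀ e as → 0 < bwdUses N e as → (e , bwd) ∈ as
  bwdUses>0⇒∈ e ((e′ , fwd) ∷ as) pos = there (bwdUses>0⇒∈ e as pos)
  bwdUses>0⇒∈ e ((e′ , bwd) ∷ as) pos with e ≟ e′
  ... | yes refl = here refl
  ... | no _     = there (bwdUses>0⇒∈ e as pos)

  bwdUses≡0 : ∀ e as → All (tail e ≢_) (map (dst N) as) → bwdUses N e as ≡ 0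
  bwdUses≡0 e []                _           = refl
  bwdUses≡0 e ((e′ , fwd) ∷ as) (_ ∷ avoid) = bwdUses≡0 e as avoid
  bwdUses≡0 e ((e′ , bwd) ∷ as) (tail≢ ∷ avoid) with e ≟ e′
  ... | yes refl = ⊥-elim (tail≢ refl)
  ... | no _     = bwdUses≡0 e as avoid

  -- All reverse arcs of e end at its tail, so distinct arc ends allow at most one of them.
  *-bwdUses≤ : ∀ (f : Flow N) δ e as → Unique (map (dst N) as) → All (λ a → δ ≤ rescap N f a) as →
               δ * bwdUses N e as ≤ f e
  *-bwdUses≤ f δ e []                _            _           = ≤-trans (≤-reflexive (*-zeroʳ δ)) z≤n
  *-bwdUses≤ f δ e ((e′ , fwd) ∷ as) (_ ∷ uniq)   (_ ∷ fits)  = *-bwdUses≤ f δ e as uniq fits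
  *-bwdUses≤ f δ e ((e′ , bwd) ∷ as) (avoid ∷ uniq) (δ≤ ∷ fits) with e ≟ e′
  ... | yes refl rewrite bwdUses≡0 e as avoid | *-identityʳ δ = δ≤
  ... | no _     = *-bwdUses≤ f δ e as uniq fits

  entering : Fin n → List (Arc N) → ℕ
  entering v as = sum (map (λ a → pointMass (dst N a) 1 v) as)

  leaving : Fin n → List (Arc N) → ℕ
  leaving v as = sum (map (λ a → pointMass (src N a) 1 v) as)

  Fwd Bwd : List (Arc N) → Flow N
  Fwd as e = fwdUses N e as
  Bwd as e = bwdUses N e as

  uses-entering : ∀ as v → inflow N (Fwd as) v + outflow N (Bwd as) v ≡ entering v as
  uses-entering [] v = cong₂ _+_ (sumWhere-0 _ (allFin m)) (sumWhere-0 _ (allFin m))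
  uses-entering ((e′ , fwd) ∷ as) v = begin
    inflow N (Fwd ((e′ , fwd) ∷ as)) v + O  ≡⟨ cong (_+ O) (sumWhere-pointMass-+ head v e′ (Fwd as)) ⟩
    pointMass (head e′) 1 v + I + O        ≡⟨ +-assoc (pointMass (head e′) 1 v) I O ⟩
    pointMass (head e′) 1 v + (I + O)      ≡⟨ cong (pointMass (head e′) 1 v +_) (uses-entering as v) ⟩
    entering v ((e′ , fwd) ∷ as)           ∎
    where
    open ≡-Reasoning
    I O : ℕ
    I = inflow N (Fwd as) v
    O = outflow N (Bwd as) v
  uses-entering ((e′ , bwd) ∷ as) v = begin
    I + outflow N (Bwd ((e′ , bwd) ∷ as)) v ≡⟨ cong (I +_) (sumWhere-pointMass-+ tail v e′ (Bwd as)) ⟩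
    I + (pointMass (tail e′) 1 v + O)      ≡⟨ x∙yz≈y∙xz I (pointMass (tail e′) 1 v) O ⟩
    pointMass (tail e′) 1 v + (I + O)      ≡⟨ cong (pointMass (tail e′) 1 v +_) (uses-entering as v) ⟩
    entering v ((e′ , bwd) ∷ as)           ∎
    where
    open ≡-Reasoning
    I O : ℕ
    I = inflow N (Fwd as) v
    O = outflow N (Bwd as) v

  uses-leaving : ∀ as v → inflow N (Bwd as) v + outflow N (Fwd as) v ≡ leaving v as
  uses-leaving [] v = cong₂ _+_ (sumWhere-0 _ (allFin m)) (sumWhere-0 _ (allFin m))
  uses-leaving ((e′ , fwd) ∷ as) v = begin
    I + outflow N (Fwd ((e′ , fwd) ∷ as)) v ≡⟨ cong (I +_) (sumWhere-pointMass-+ tail v e′ (Fwd as)) ⟩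
    I + (pointMass (tail e′) 1 v + O)      ≡⟨ x∙yz≈y∙xz I (pointMass (tail e′) 1 v) O ⟩
    pointMass (tail e′) 1 v + (I + O)      ≡⟨ cong (pointMass (tail e′) 1 v +_) (uses-leaving as v) ⟩
    leaving v ((e′ , fwd) ∷ as)            ∎
    where
    open ≡-Reasoning
    I O : ℕ
    I = inflow N (Bwd as) v
    O = outflow N (Fwd as) v
  uses-leaving ((e′ , bwd) ∷ as) v = begin
    inflow N (Bwd ((e′ , bwd) ∷ as)) v + O  ≡⟨ cong (_+ O) (sumWhere-pointMass-+ head v e′ (Bwd as)) ⟩
    pointMass (head e′) 1 v + I + O        ≡⟨ +-assoc (pointMass (head e′) 1 v) I O ⟩
    pointMass (head e′) 1 v + (I + O)      ≡⟨ cong (pointMass (head e′) 1 v +_) (uses-leaving as v) ⟩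
    leaving v ((e′ , bwd) ∷ as)            ∎
    where
    open ≡-Reasoning
    I O : ℕ
    I = inflow N (Bwd as) v
    O = outflow N (Fwd as) v

  walk-count : Walk N g x y as → ∀ v → pointMass x 1 v + entering v as ≡ pointMass y 1 v + leaving v as
  walk-count []                              v = refl
  walk-count {y = y} {as = a ∷ as} ((refl , _) ∷ W) v =
    trans (cong (pointMass (src N a) 1 v +_) (walk-count W v))
          (x∙yz≈y∙xz (pointMass (src N a) 1 v) (pointMass y 1 v) (leaving v as))

  module Augmentation (f : Flow N) (δ : ℕ) {x w qs} (Q : Walk N f x w qs)
                      (uniq : Unique (map (dst N) qs)) (fits : All (λ a → δ ≤ rescap N f a) qs) where

    h : Flow N
    h = augment N f qs δ

    inᶠ outᶠ inʰ outʰ : Fin n → ℕ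
    inᶠ  = inflow N f
    outᶠ = outflow N f
    inʰ  = inflow N h
    outʰ = outflow N h

    inʰ+outᶠ inᶠ+outʰ : Fin n → ℕ
    inʰ+outᶠ v = inʰ v + outᶠ v
    inᶠ+outʰ v = inᶠ v + outʰ v

    augment-+-bwdUses : ∀ e → h e + δ * Bwd qs e ≡ f e + δ * Fwd qs e
    augment-+-bwdUses e = m∸n+n≡m (≤-trans (*-bwdUses≤ f δ e qs uniq fits) (m≤m+n (f e) _))

    flow-change : ∀ v → inʰ+outᶠ v + δ * leaving v qs ≡ inᶠ+outʰ v + δ * entering v qs
    flow-change v = begin
      inʰ+outᶠ v + δ * leaving v qs                  ≡⟨ cong (λ c → inʰ+outᶠ v + δ * c) (uses-leaving qs v) ⟨
      inʰ+outᶠ v + δ * (In Bwd + Out Fwd)            ≡⟨ cong (inʰ+outᶠ v +_) (*-distribˡ-+ δ (In Bwd) (Out Fwd)) ⟩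
      inʰ+outᶠ v + (δ * In Bwd + δ * Out Fwd)        ≡⟨ interchange (inʰ v) (outᶠ v) (δ * In Bwd) (δ * Out Fwd) ⟩
      (inʰ v + δ * In Bwd) + (outᶠ v + δ * Out Fwd)  ≡⟨ cong₂ _+_ in-change (sym out-change) ⟩
      (inᶠ v + δ * In Fwd) + (outʰ v + δ * Out Bwd)  ≡⟨ interchange (inᶠ v) (δ * In Fwd) (outʰ v) (δ * Out Bwd) ⟩
      inᶠ+outʰ v + (δ * In Fwd + δ * Out Bwd)        ≡⟨ cong (inᶠ+outʰ v +_) (*-distribˡ-+ δ (In Fwd) (Out Bwd)) ⟨
      inᶠ+outʰ v + δ * (In Fwd + Out Bwd)            ≡⟨ cong (λ c → inᶠ+outʰ v + δ * c) (uses-entering qs v) ⟩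
      inᶠ+outʰ v + δ * entering v qs                 ∎
      where
      open ≡-Reasoning
      In Out : (List (Arc N) → Flow N) → ℕ
      In  uses = inflow N (uses qs) v
      Out uses = outflow N (uses qs) v
      in-change : inʰ v + δ * In Bwd ≡ inᶠ v + δ * In Fwd
      in-change = sumWhere-affine (λ e → ⌊ head e ≟ v ⌋) δ h (Bwd qs) f (Fwd qs) (allFin m) augment-+-bwdUses
      out-change : outʰ v + δ * Out Bwd ≡ outᶠ v + δ * Out Fwd
      out-change = sumWhere-affine (λ e → ⌊ tail e ≟ v ⌋) δ h (Bwd qs) f (Fwd qs) (allFin m) augment-+-bwdUses

    -- Sending δ along Q lowers the excess at x by δ and raises it at w by δ; stated without subtraction.
    balance : ∀ v → pointMass x δ v + inʰ+outᶠ v ≡ pointMass w δ v + inᶠ+outʰ v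
    balance v = +-cancelʳ-≡ (δ * leaving v qs) _ _ (begin
      (pointMass x δ v + inʰ+outᶠ v) + δ * leaving v qs   ≡⟨ +-assoc (pointMass x δ v) (inʰ+outᶠ v) _ ⟩
      pointMass x δ v + (inʰ+outᶠ v + δ * leaving v qs)   ≡⟨ cong (pointMass x δ v +_) (flow-change v) ⟩
      pointMass x δ v + (inᶠ+outʰ v + δ * entering v qs)  ≡⟨ x∙yz≈y∙xz (pointMass x δ v) (inᶠ+outʰ v) _ ⟩
      inᶠ+outʰ v + (pointMass x δ v + δ * entering v qs)  ≡⟨ cong (inᶠ+outʰ v +_) path-change ⟩
      inᶠ+outʰ v + (pointMass w δ v + δ * leaving v qs)   ≡⟨ x∙yz≈y∙xz (inᶠ+outʰ v) (pointMass w δ v) _ ⟩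
      pointMass w δ v + (inᶠ+outʰ v + δ * leaving v qs)   ≡⟨ +-assoc (pointMass w δ v) (inᶠ+outʰ v) _ ⟨
      (pointMass w δ v + inᶠ+outʰ v) + δ * leaving v qs   ∎)
      where
      open ≡-Reasoning
      path-change : pointMass x δ v + δ * entering v qs ≡ pointMass w δ v + δ * leaving v qs
      path-change = begin
        pointMass x δ v + δ * entering v qs       ≡⟨ cong (_+ δ * entering v qs) (*-pointMass δ x v) ⟨
        δ * pointMass x 1 v + δ * entering v qs   ≡⟨ *-distribˡ-+ δ (pointMass x 1 v) (entering v qs) ⟨
        δ * (pointMass x 1 v + entering v qs)     ≡⟨ cong (δ *_) (walk-count Q v) ⟩
        δ * (pointMass w 1 v + leaving v qs)      ≡⟨ *-distribˡ-+ δ (pointMass w 1 v) (leaving v qs) ⟩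
        δ * pointMass w 1 v + δ * leaving v qs    ≡⟨ cong (_+ δ * leaving v qs) (*-pointMass δ w v) ⟩
        pointMass w δ v + δ * leaving v qs        ∎

    A'-reflect : ∀ {v} → w ≢ v → A' N h v → A' N f v
    A'-reflect {v} w≢v (v≢s , v≢t , outʰ<inʰ) = v≢s , v≢t , +-cancelˡ-< (outʰ v) _ _ (begin-strict
      outʰ v + outᶠ v                    <⟨ +-monoˡ-< (outᶠ v) outʰ<inʰ ⟩
      inʰ v + outᶠ v                     ≤⟨ m≤n+m (inʰ v + outᶠ v) (pointMass x δ v) ⟩
      pointMass x δ v + (inʰ v + outᶠ v) ≡⟨ trans (balance v) (cong (_+ (inᶠ v + outʰ v)) (pointMass-≢ δ w≢v)) ⟩
      inᶠ v + outʰ v                     ≡⟨ +-comm (inᶠ v) (outʰ v) ⟩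
      outʰ v + inᶠ v                     ∎)
      where open ≤-Reasoning

    B'-reflect : ∀ {v} → x ≢ v → B' N h v → B' N f v
    B'-reflect {v} x≢v (v≢s , v≢t , inʰ<outʰ) = v≢s , v≢t , +-cancelˡ-< (inʰ v) _ _ (begin-strict
      inʰ v + inᶠ v                      ≡⟨ +-comm (inʰ v) (inᶠ v) ⟩
      inᶠ v + inʰ v                      <⟨ +-monoʳ-< (inᶠ v) inʰ<outʰ ⟩
      inᶠ v + outʰ v                     ≤⟨ m≤n+m (inᶠ v + outʰ v) (pointMass w δ v) ⟩
      pointMass w δ v + (inᶠ v + outʰ v) ≡⟨ trans (sym (cong (_+ (inʰ v + outᶠ v)) (pointMass-≢ δ x≢v))) (balance v) ⟨
      inʰ v + outᶠ v                     ∎)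
      where open ≤-Reasoning

    start-¬B' : x ≢ w → A' N f x → δ ≤ excess N f x → ¬ B' N h x
    start-¬B' x≢w (_ , _ , outᶠ<inᶠ) δ≤excess (_ , _ , inʰ<outʰ) = <-irrefl refl (begin-strict
      δ + (inʰ x + outᶠ x)               <⟨ +-monoʳ-< δ (+-monoˡ-< (outᶠ x) inʰ<outʰ) ⟩
      δ + (outʰ x + outᶠ x)              ≡⟨ x∙yz≈xz∙y δ (outʰ x) (outᶠ x) ⟩
      (δ + outᶠ x) + outʰ x              ≤⟨ +-monoˡ-≤ (outʰ x) (+-monoˡ-≤ (outᶠ x) δ≤excess) ⟩
      (excess N f x + outᶠ x) + outʰ x   ≡⟨ cong (_+ outʰ x) (m∸n+n≡m (<⇒≤ outᶠ<inᶠ)) ⟩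
      inᶠ x + outʰ x                     ≡⟨ balance-at-start ⟨
      δ + (inʰ x + outᶠ x)               ∎)
      where
      open ≤-Reasoning
      balance-at-start : δ + (inʰ x + outᶠ x) ≡ inᶠ x + outʰ x
      balance-at-start = begin-equality
        δ + (inʰ x + outᶠ x)               ≡⟨ cong (_+ (inʰ x + outᶠ x)) (pointMass-refl x δ) ⟨
        pointMass x δ x + (inʰ x + outᶠ x) ≡⟨ balance x ⟩
        pointMass w δ x + (inᶠ x + outʰ x) ≡⟨ cong (_+ (inᶠ x + outʰ x)) (pointMass-≢ δ (≢-sym x≢w)) ⟩
        inᶠ x + outʰ x                     ∎

    end-¬A' : x ≢ w → B' N f w → δ ≤ deficit N f w → ¬ A' N h w
    end-¬A' x≢w (_ , _ , inᶠ<outᶠ) δ≤deficit (_ , _ , outʰ<inʰ) = <-irrefl refl (begin-strict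
      δ + (inᶠ w + outʰ w)               <⟨ +-monoʳ-< δ (+-monoʳ-< (inᶠ w) outʰ<inʰ) ⟩
      δ + (inᶠ w + inʰ w)                ≡⟨ +-assoc δ (inᶠ w) (inʰ w) ⟨
      (δ + inᶠ w) + inʰ w                ≤⟨ +-monoˡ-≤ (inʰ w) (+-monoˡ-≤ (inᶠ w) δ≤deficit) ⟩
      (deficit N f w + inᶠ w) + inʰ w    ≡⟨ cong (_+ inʰ w) (m∸n+n≡m (<⇒≤ inᶠ<outᶠ)) ⟩
      outᶠ w + inʰ w                     ≡⟨ +-comm (outᶠ w) (inʰ w) ⟩
      inʰ w + outᶠ w                     ≡⟨ balance-at-end ⟩
      δ + (inᶠ w + outʰ w)               ∎)
      where
      open ≤-Reasoning
      balance-at-end : inʰ w + outᶠ w ≡ δ + (inᶠ w + outʰ w)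
      balance-at-end = begin-equality
        inʰ w + outᶠ w                     ≡⟨ cong (_+ (inʰ w + outᶠ w)) (pointMass-≢ δ x≢w) ⟨
        pointMass x δ w + (inʰ w + outᶠ w) ≡⟨ balance w ⟩
        pointMass w δ w + (inᶠ w + outʰ w) ≡⟨ cong (_+ (inᶠ w + outʰ w)) (pointMass-refl w δ) ⟩
        δ + (inᶠ w + outʰ w)               ∎

    Bwd≡0⇒f≤h : ∀ e → Bwd qs e ≡ 0 → f e ≤ h e
    Bwd≡0⇒f≤h e unused rewrite unused | *-zeroʳ δ = m≤m+n (f e) (δ * Fwd qs e)

    Fwd≡0⇒h≤f : ∀ e → Fwd qs e ≡ 0 → h e ≤ f e
    Fwd≡0⇒h≤f e unused rewrite unused | *-zeroʳ δ | +-identityʳ (f e) = m∸n≤m (f e) (δ * Bwd qs e)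

    augment-residual : ∀ a → 0 < rescap N h a → 0 < rescap N f a ⊎ reverse a ∈ qs
    augment-residual (e , fwd) pos with Bwd qs e ≟ℕ 0
    ... | yes unused = inj₁ (<-≤-trans pos (∸-monoʳ-≤ (cap e) (Bwd≡0⇒f≤h e unused)))
    ... | no  used   = inj₂ (bwdUses>0⇒∈ e qs (n≢0⇒n>0 used))
    augment-residual (e , bwd) pos with Fwd qs e ≟ℕ 0
    ... | yes unused = inj₁ (<-≤-trans pos (Fwd≡0⇒h≤f e unused))
    ... | no  used   = inj₂ (fwdUses>0⇒∈ e qs (n≢0⇒n>0 used))

    reachable-step : ∀ {P} → P x → ∀ a → 0 < rescap N h a → Reachable f P (src N a) → Reachable f P (dst N a)
    reachable-step Px a pos (z , Pz , ws , W) with augment-residual a pos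
    ... | inj₁ pos′ = z , Pz , ws ++ a ∷ [] , walk-snoc {a = a} W pos′
    ... | inj₂ ra∈  = x , Px , subst (λ y → ∃[ ws ] Walk N f x y ws) (src-reverse a) (walk-prefix Q ra∈)

    coreachable-step : ∀ {P} → P w → ∀ a → 0 < rescap N h a → Coreachable f P (dst N a) → Coreachable f P (src N a)
    coreachable-step Pw a pos (z , Pz , ws , W) with augment-residual a pos
    ... | inj₁ pos′ = z , Pz , a ∷ ws , (refl , pos′) ∷ W
    ... | inj₂ ra∈  = w , Pw , subst (λ y → ∃[ ws ] Walk N f y w ws) (dst-reverse a) (walk-suffix Q ra∈)

lemma1 : (N : Network) (f : Flow N) →
  Feasible N f →
  ¬ Conserves N f →
  NoPathAB N f →
  (as : List (Arc N)) (δ : ℕ) →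
  0 < δ →
  All (λ a → δ ≤ rescap N f a) as →
  (Σ (Fin (Network.n N)) (λ a → A' N f a × ResPath N f a (Network.s N) as × δ ≤ excess N f a)
    ⊎ Σ (Fin (Network.n N)) (λ b → B' N f b × ResPath N f (Network.t N) b as × δ ≤ deficit N f b)) →
  NoPathAB N (augment N f as δ)
lemma1 N f _ _ noPath qs δ _ fits (inj₁ (a , A'a , (Q , _ ∷ uniq) , δ≤excess)) u v ps A'u B'v (W , _) =
  NoPathAB⇒¬Reachable N noPath B'ᶠv
    (walk-preserves N (Reachable N f (A' N f)) (reachable-step A'a) W (u , A'ᶠu , [] , []))
  where
  open Augmentation N f δ Q uniq fits
  A'ᶠu : A' N f u
  A'ᶠu = A'-reflect (≢-sym (proj₁ A'u)) A'u
  B'ᶠv : B' N f v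
  B'ᶠv with v ≟ a
  ... | yes refl = ⊥-elim (start-¬B' (proj₁ A'a) A'a δ≤excess B'v)
  ... | no  v≢a  = B'-reflect (≢-sym v≢a) B'v
lemma1 N f _ _ noPath qs δ _ fits (inj₂ (b , B'b , (Q , _ ∷ uniq) , δ≤deficit)) u v ps A'u B'v (W , _) =
  NoPathAB⇒¬Coreachable N noPath A'ᶠu
    (walk-reflects N (Coreachable N f (B' N f)) (coreachable-step B'b) W (v , B'ᶠv , [] , []))
  where
  open Augmentation N f δ Q uniq fits
  A'ᶠu : A' N f u
  A'ᶠu with u ≟ b
  ... | yes refl = ⊥-elim (end-¬A' (≢-sym (proj₁ (proj₂ B'b))) B'b δ≤deficit A'u)
  ... | no  u≢b  = A'-reflect (≢-sym u≢b) A'u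
  B'ᶠv : B' N f v
  B'ᶠv = B'-reflect (≢-sym (proj₁ (proj₂ B'v))) B'v
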